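{- Let $N\ge1$, $0\le r\le N$, $\lambda\in\mathbb{C}$, and let $f$ be a vertex function on $\mathcal{C}_3^N$ supported in $\Sigma_r=\{v:d(v)=r\}$ with $A_0f=\lambda f$ and $A_-f=0$. Define $m(r,k,\lambda)$ for integers $k\ge0$ by $m(r,0,\lambda)=2N-3r-\lambda$ and $m(r,k,\lambda)=m(r,k-1,\lambda)+(2N-3r-4k)-\lambda$ for $k\ge1$. Then for every integer $k\ge0$, $A_-A_+^{k+1}f=m(r,k,\lambda)\,A_+^kf$.
   Context: Vertices of $\mathcal{C}_3^N$ are elements $v=(\ell_1,\dots,\ell_N)$ of $\mathbb{Z}_3^N$ with $\ell_i\in\{ -1,0,1\}$; $v\sim w$ iff $v-w=\pm e_k$ (mod 3) for some $k$. Levels: $d_k(v)=|\ell_k|$, $d(v)=\sum_kd_k(v)$. $\tilde v_k$ is the vertex obtained from $v$ by replacing $\ell_k$ by $-\ell_k$. Vertex functions are maps $\mathbb{Z}_3^N\to\mathbb{C}$. Outer adjacency: $(A_+f)(v)=\sum_{w\sim v,\ d(w)=d(v)-1}f(w)$; inner adjacency (adjoint of $A_+$): $(A_-f)(v)=\sum_{w\sim v,\ d(w)=d(v)+1}f(w)$; neutral adjacency: $(A_0f)(v)=\sum_{k:\,d_k(v)=1}f(\tilde v_k)$. -}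

module Defs where

open import Level using (Level)
open import Data.Nat as ℕ using (ℕ; zero; suc)
open import Data.Nat.Properties using () renaming (_≟_ to _≟ℕ_)
open import Data.Integer as ℤ using (ℤ; +_; -[1+_])
open import Data.Fin using (Fin; zero; suc)
open import Data.Vec using (Vec; []; _∷_; lookup; updateAt)
open import Data.Bool using (Bool; if_then_else_)
open import Relation.Nullary.Decidable using (⌊_⌋)
open import Algebra.Bundles using (CommutativeRing)

-- Elements of ℤ₃ with representatives -1, 0, 1.
data Tri : Set where
  m1 z p1 : Tri

inc : Tri → Tri
inc m1 = z
inc z  = p1
inc p1 = m1

dec : Tri → Tri
dec m1 = p1
dec z  = m1
dec p1 = z

neg : Tri → Tri
neg m1 = p1
neg z  = z
neg p1 = m1

absT : Tri → ℕ
absT z = 0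
absT m1 = 1
absT p1 = 1

Vertex : ℕ → Set
Vertex N = Vec Tri N

dk : ∀ {N} → Vertex N → Fin N → ℕ
dk v k = absT (lookup v k)

d : ∀ {N} → Vertex N → ℕ
d [] = 0
d (x ∷ v) = absT x ℕ.+ d v

plusE minusE : ∀ {N} → Vertex N → Fin N → Vertex N
plusE v k = updateAt v k inc
minusE v k = updateAt v k dec

tilde : ∀ {N} → Vertex N → Fin N → Vertex N
tilde v k = updateAt v k neg

module Ops {c ℓ : Level} (R : CommutativeRing c ℓ) where
  open CommutativeRing R hiding (zero)

  sumFin : ∀ n → (Fin n → Carrier) → Carrier
  sumFin zero g = 0#
  sumFin (suc n) g = g zero + sumFin n (λ i → g (suc i))

  VFun : ℕ → Set c
  VFun N = Vertex N → Carrier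

  when : Bool → Carrier → Carrier
  when b x = if b then x else 0#

  -- The neighbours of v are exactly the vertices v + e_k and v - e_k (k ∈ Fin N),
  -- all distinct. Outer adjacency sums over neighbours w with d(w) = d(v) - 1.
  A₊ : ∀ {N} → VFun N → VFun N
  A₊ {N} f v = sumFin N (λ k →
      when ⌊ ℕ.suc (d (plusE v k)) ≟ℕ d v ⌋ (f (plusE v k))
    + when ⌊ ℕ.suc (d (minusE v k)) ≟ℕ d v ⌋ (f (minusE v k)))

  A₋ : ∀ {N} → VFun N → VFun N
  A₋ {N} f v = sumFin N (λ k →
      when ⌊ d (plusE v k) ≟ℕ ℕ.suc (d v) ⌋ (f (plusE v k))
    + when ⌊ d (minusE v k) ≟ℕ ℕ.suc (d v) ⌋ (f (minusE v k)))

  A₀ : ∀ {N} → VFun N → VFun N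
  A₀ {N} f v = sumFin N (λ k → when ⌊ dk v k ≟ℕ 1 ⌋ (f (tilde v k)))

  iter : ∀ {N} → ℕ → (VFun N → VFun N) → VFun N → VFun N
  iter zero T f = f
  iter (suc k) T f = T (iter k T f)

  natR : ℕ → Carrier
  natR zero = 0#
  natR (suc n) = 1# + natR n

  intR : ℤ → Carrier
  intR (+ n) = natR n
  intR -[1+ n ] = - natR (suc n)

  m : (N r k : ℕ) → Carrier → Carrier
  m N r zero λ′ = intR ((+ (2 ℕ.* N)) ℤ.- (+ (3 ℕ.* r))) - λ′
  m N r (suc k) λ′ =
    m N r k λ′ + intR ((+ (2 ℕ.* N)) ℤ.- (+ (3 ℕ.* r)) ℤ.- (+ (4 ℕ.* suc k))) - λ′

{-# OPTIONS --safe #-}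
module Submission where

-- Splitting off the first coordinate of C₃ᴺ and inducting on N gives the commutation relations
--   A₋A₊ − A₊A₋ = 2N − 3d − A₀   and   A₀A₊ − A₊A₀ = A₊,
-- where d acts on a vertex function by multiplication with the level. Consequently A₊ᵏf lives on
-- Σ_{r+k} and satisfies A₀A₊ᵏf = (λ + k)A₊ᵏf. If A₊A₋A₊ᵏf = κA₊ᵏf (κ = 0 for k = 0 since A₋f = 0,
-- and κ = m(r,k−1,λ) by induction otherwise), the first relation yields
-- A₋A₊ᵏ⁺¹f = (κ + 2N − (λ + k) − 3(r + k))A₊ᵏf, and this coefficient is m(r,k,λ).

open import Defs
open import Level using (_⊔_)
open import Data.Nat as ℕ using (ℕ; zero; suc; _≤_)
open import Data.Nat.Properties
  using (_≟_; 1+n≢n; m+1+n≢n; m≢1+n+m; *-suc; *-distribˡ-+)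
open import Data.Integer as ℤ using (+_; _⊖_)
import Data.Integer.Properties as ℤP
open import Data.Fin using (Fin)
open import Data.Vec using ([]; _∷_)
open import Data.Bool using (Bool; true; false)
open import Data.Maybe using (nothing)
open import Function using (_∘_)
open import Relation.Nullary using (Dec; yes; no; ¬_; contradiction)
open import Relation.Nullary.Decidable using (⌊_⌋; isYes≗does)
open import Relation.Binary.PropositionalEquality as P using (_≡_; _≢_)
open import Algebra.Bundles using (CommutativeRing)
open import Tactic.RingSolver.Core.AlmostCommutativeRing using (fromCommutativeRing)

[+a-+b]-+c≡a⊖[b+c] : ∀ a b c → (+ a ℤ.- + b) ℤ.- + c ≡ a ⊖ (b ℕ.+ c)
[+a-+b]-+c≡a⊖[b+c] a b c = begin
  (+ a ℤ.- + b) ℤ.- + c          ≡⟨ ℤP.+-assoc (+ a) (ℤ.- + b) (ℤ.- + c) ⟩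
  + a ℤ.+ (ℤ.- + b ℤ.+ ℤ.- + c)  ≡⟨ P.cong (ℤ._+_ (+ a)) (ℤP.neg-distrib-+ (+ b) (+ c)) ⟨
  + a ℤ.- + (b ℕ.+ c)            ≡⟨ ℤP.m-n≡m⊖n a (b ℕ.+ c) ⟩
  a ⊖ (b ℕ.+ c)                  ∎
  where open P.≡-Reasoning

module CubeAdjacency {c ℓ} (R : CommutativeRing c ℓ) where
  open CommutativeRing R hiding (zero)
  open Ops R
  open import Algebra.Properties.Ring ring using ([y-z]x≈yx-zx)
  open import Algebra.Properties.Group +-group using (//-rightDividesʳ)
  open import Algebra.Properties.CommutativeSemigroup +-commutativeSemigroup
    using (interchange; x∙yz≈y∙xz; xy∙z≈x∙zy; xy∙z≈xz∙y)
  open import Algebra.Properties.Semiring.Sum semiring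
    using (sum; sum-cong-≋; ∑-distrib-+; *-distribˡ-sum; sum-replicate-zero)
  open import Relation.Binary.Reasoning.Setoid setoid
  open import Algebra.Solver.CommutativeMonoid +-commutativeMonoid using (solve; _⊜_; _⊕_)
  open import Tactic.RingSolver.NonReflective (fromCommutativeRing R (λ _ → nothing))
    using () renaming (solve to ring-solve; _⊜_ to _≐_; _⊕_ to _⊞_; ⊝_ to ⊟_)

  sumFin≈sum : ∀ n (g : Fin n → Carrier) → sumFin n g ≈ sum g
  sumFin≈sum zero    g = refl
  sumFin≈sum (suc n) g = +-congˡ (sumFin≈sum n (g ∘ Fin.suc))

  sumFin-cong : ∀ n {g h : Fin n → Carrier} → (∀ k → g k ≈ h k) → sumFin n g ≈ sumFin n h
  sumFin-cong n {g} {h} g≈h = trans (sumFin≈sum n g) (trans (sum-cong-≋ g≈h) (sym (sumFin≈sum n h)))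

  sumFin-+ : ∀ n (g h : Fin n → Carrier) → sumFin n (λ k → g k + h k) ≈ sumFin n g + sumFin n h
  sumFin-+ n g h = trans (sumFin≈sum n _)
    (trans (∑-distrib-+ g h) (sym (+-cong (sumFin≈sum n g) (sumFin≈sum n h))))

  sumFin-* : ∀ n a (g : Fin n → Carrier) → sumFin n (λ k → a * g k) ≈ a * sumFin n g
  sumFin-* n a g = trans (sumFin≈sum n _)
    (trans (sym (*-distribˡ-sum a g)) (*-congˡ (sym (sumFin≈sum n g))))

  sumFin-zero : ∀ n → sumFin n (λ _ → 0#) ≈ 0#
  sumFin-zero n = trans (sumFin≈sum n _) (sum-replicate-zero n)

  when-cong : ∀ b {x y} → x ≈ y → when b x ≈ when b y
  when-cong true  x≈y = x≈y
  when-cong false _   = refl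

  when-+ : ∀ b x y → when b (x + y) ≈ when b x + when b y
  when-+ true  x y = refl
  when-+ false x y = sym (+-identityʳ 0#)

  when-* : ∀ b a x → when b (a * x) ≈ a * when b x
  when-* true  a x = refl
  when-* false a x = sym (zeroʳ a)

  when-≡ : ∀ {b b′ x} → b ≡ b′ → when b x ≈ when b′ x
  when-≡ P.refl = refl

  when-yes : ∀ {p} {P : Set p} {x} (p? : Dec P) → P → when ⌊ p? ⌋ x ≈ x
  when-yes (yes _) _ = refl
  when-yes (no ¬p) p = contradiction p ¬p

  when-no : ∀ {p} {P : Set p} {x} (p? : Dec P) → ¬ P → when ⌊ p? ⌋ x ≈ 0#
  when-no (yes p) ¬p = contradiction p ¬p
  when-no (no _)  _  = refl

  when-n≟n : ∀ n {x} → when ⌊ n ≟ n ⌋ x ≈ x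
  when-n≟n n = when-yes (n ≟ n) P.refl

  when-1+n≟n : ∀ n {x} → when ⌊ suc n ≟ n ⌋ x ≈ 0#
  when-1+n≟n n = when-no (suc n ≟ n) 1+n≢n

  when-n≟1+n : ∀ n {x} → when ⌊ n ≟ suc n ⌋ x ≈ 0#
  when-n≟1+n n = when-no (n ≟ suc n) (1+n≢n ∘ P.sym)

  when-2+n≟n : ∀ n {x} → when ⌊ suc (suc n) ≟ n ⌋ x ≈ 0#
  when-2+n≟n n = when-no (suc (suc n) ≟ n) (m+1+n≢n 1)

  when-n≟2+n : ∀ n {x} → when ⌊ n ≟ suc (suc n) ⌋ x ≈ 0#
  when-n≟2+n n = when-no (n ≟ suc (suc n)) (m≢1+n+m n)

  heads-vanish : ∀ {x y t} → x ≈ 0# → y ≈ 0# → (x + y) + t ≈ t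
  heads-vanish x≈0 y≈0 = trans (+-congʳ (trans (+-cong x≈0 y≈0) (+-identityʳ 0#))) (+-identityˡ _)

  infix 4 _≋_
  _≋_ : ∀ {N} → VFun N → VFun N → Set ℓ
  g ≋ h = ∀ v → g v ≈ h v

  record IsLinear {N} (T : VFun N → VFun N) : Set (c ⊔ ℓ) where
    field
      cong        : ∀ {g h} → g ≋ h → T g ≋ T h
      additive    : ∀ g h → T (λ u → g u + h u) ≋ λ v → T g v + T h v
      homogeneous : ∀ a g → T (λ u → a * g u) ≋ λ v → a * T g v

  open IsLinear public

  linear-vanishes : ∀ {N} {T : VFun N → VFun N} → IsLinear T →
                    ∀ {g} → g ≋ (λ _ → 0#) → T g ≋ λ _ → 0#
  linear-vanishes {T = T} T-lin {g} g≋0 v = begin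
    T g v                   ≈⟨ cong T-lin (λ u → trans (g≋0 u) (sym (zeroˡ (g u)))) v ⟩
    T (λ u → 0# * g u) v    ≈⟨ homogeneous T-lin 0# g v ⟩
    0# * T g v              ≈⟨ zeroˡ _ ⟩
    0#                      ∎

  weighted-pullback-linear : ∀ {N} (b : Vertex N → Bool) (t : Vertex N → Vertex N) →
                             IsLinear (λ g v → when (b v) (g (t v)))
  weighted-pullback-linear b t = record
    { cong        = λ g≋h v → when-cong (b v) (g≋h (t v))
    ; additive    = λ g h v → when-+ (b v) (g (t v)) (h (t v))
    ; homogeneous = λ a g v → when-* (b v) a (g (t v))
    }

  +-linear : ∀ {N} {S T : VFun N → VFun N} → IsLinear S → IsLinear T →
             IsLinear (λ g v → S g v + T g v)
  +-linear S-lin T-lin = record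
    { cong        = λ g≋h v → +-cong (cong S-lin g≋h v) (cong T-lin g≋h v)
    ; additive    = λ g h v →
        trans (+-cong (additive S-lin g h v) (additive T-lin g h v)) (interchange _ _ _ _)
    ; homogeneous = λ a g v →
        trans (+-cong (homogeneous S-lin a g v) (homogeneous T-lin a g v)) (sym (distribˡ a _ _))
    }

  sumFin-linear : ∀ {N} n {T : Fin n → VFun N → VFun N} → (∀ k → IsLinear (T k)) →
                  IsLinear (λ g v → sumFin n (λ k → T k g v))
  sumFin-linear n T-lin = record
    { cong        = λ g≋h v → sumFin-cong n (λ k → cong (T-lin k) g≋h v)
    ; additive    = λ g h v →
        trans (sumFin-cong n (λ k → additive (T-lin k) g h v)) (sumFin-+ n _ _)
    ; homogeneous = λ a g v →
        trans (sumFin-cong n (λ k → homogeneous (T-lin k) a g v)) (sumFin-* n a _)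
    }

  A₊-linear : ∀ {N} → IsLinear (A₊ {N})
  A₊-linear {N} = sumFin-linear N (λ k →
    +-linear (weighted-pullback-linear _ (λ v → plusE v k))
             (weighted-pullback-linear _ (λ v → minusE v k)))

  A₋-linear : ∀ {N} → IsLinear (A₋ {N})
  A₋-linear {N} = sumFin-linear N (λ k →
    +-linear (weighted-pullback-linear _ (λ v → plusE v k))
             (weighted-pullback-linear _ (λ v → minusE v k)))

  A₀-linear : ∀ {N} → IsLinear (A₀ {N})
  A₀-linear {N} = sumFin-linear N (λ k → weighted-pullback-linear _ (λ v → tilde v k))

  slice : ∀ {N} → Tri → VFun (suc N) → VFun N
  slice x g w = g (x ∷ w)

  data IsUnit : Tri → Set where
    p1-unit : IsUnit p1
    m1-unit : IsUnit m1

  neg-unit : ∀ {x} → IsUnit x → IsUnit (neg x)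
  neg-unit p1-unit = m1-unit
  neg-unit m1-unit = p1-unit

  -- Only `does` computes through ℕ._≟_; ⌊_⌋ (isYes) is strict in its argument.
  ⌊suc≟suc⌋ : ∀ m n → ⌊ suc m ≟ suc n ⌋ ≡ ⌊ m ≟ n ⌋
  ⌊suc≟suc⌋ m n = P.trans (isYes≗does (suc m ≟ suc n)) (P.sym (isYes≗does (m ≟ n)))

  ⌊suc[x+m]≟x+n⌋ : ∀ x m n → ⌊ suc (absT x ℕ.+ m) ≟ absT x ℕ.+ n ⌋ ≡ ⌊ suc m ≟ n ⌋
  ⌊suc[x+m]≟x+n⌋ z  m n = P.refl
  ⌊suc[x+m]≟x+n⌋ p1 m n = ⌊suc≟suc⌋ (suc m) n
  ⌊suc[x+m]≟x+n⌋ m1 m n = ⌊suc≟suc⌋ (suc m) n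

  ⌊x+m≟suc[x+n]⌋ : ∀ x m n → ⌊ absT x ℕ.+ m ≟ suc (absT x ℕ.+ n) ⌋ ≡ ⌊ m ≟ suc n ⌋
  ⌊x+m≟suc[x+n]⌋ z  m n = P.refl
  ⌊x+m≟suc[x+n]⌋ p1 m n = ⌊suc≟suc⌋ m (suc n)
  ⌊x+m≟suc[x+n]⌋ m1 m n = ⌊suc≟suc⌋ m (suc n)

  module _ {N} (g : VFun (suc N)) (w : Vertex N) where
    A₊-∷ : ∀ x → A₊ g (x ∷ w) ≈
      (when ⌊ suc (d (inc x ∷ w)) ≟ d (x ∷ w) ⌋ (g (inc x ∷ w))
        + when ⌊ suc (d (dec x ∷ w)) ≟ d (x ∷ w) ⌋ (g (dec x ∷ w)))
      + A₊ (slice x g) w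
    A₊-∷ x = +-congˡ (sumFin-cong N λ k → +-cong
      (when-≡ (⌊suc[x+m]≟x+n⌋ x (d (plusE w k)) (d w)))
      (when-≡ (⌊suc[x+m]≟x+n⌋ x (d (minusE w k)) (d w))))

    A₋-∷ : ∀ x → A₋ g (x ∷ w) ≈
      (when ⌊ d (inc x ∷ w) ≟ suc (d (x ∷ w)) ⌋ (g (inc x ∷ w))
        + when ⌊ d (dec x ∷ w) ≟ suc (d (x ∷ w)) ⌋ (g (dec x ∷ w)))
      + A₋ (slice x g) w
    A₋-∷ x = +-congˡ (sumFin-cong N λ k → +-cong
      (when-≡ (⌊x+m≟suc[x+n]⌋ x (d (plusE w k)) (d w)))
      (when-≡ (⌊x+m≟suc[x+n]⌋ x (d (minusE w k)) (d w))))

    private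
      n = d w

    A₊-∷-zero : A₊ g (z ∷ w) ≈ A₊ (slice z g) w
    A₊-∷-zero = trans (A₊-∷ z) (heads-vanish (when-2+n≟n n) (when-2+n≟n n))

    A₊-∷-unit : ∀ {x} → IsUnit x → A₊ g (x ∷ w) ≈ g (z ∷ w) + A₊ (slice x g) w
    A₊-∷-unit p1-unit = trans (A₊-∷ p1)
      (+-congʳ (trans (+-cong (when-1+n≟n (suc n)) (when-n≟n (suc n))) (+-identityˡ _)))
    A₊-∷-unit m1-unit = trans (A₊-∷ m1)
      (+-congʳ (trans (+-cong (when-n≟n (suc n)) (when-1+n≟n (suc n))) (+-identityʳ _)))

    A₋-∷-zero : ∀ {x} → IsUnit x → A₋ g (z ∷ w) ≈ (g (x ∷ w) + g (neg x ∷ w)) + A₋ (slice z g) w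
    A₋-∷-zero p1-unit = trans (A₋-∷ z)
      (+-congʳ (+-cong (when-n≟n (suc n)) (when-n≟n (suc n))))
    A₋-∷-zero m1-unit = trans (A₋-∷ z)
      (+-congʳ (trans (+-cong (when-n≟n (suc n)) (when-n≟n (suc n))) (+-comm _ _)))

    A₋-∷-unit : ∀ {x} → IsUnit x → A₋ g (x ∷ w) ≈ A₋ (slice x g) w
    A₋-∷-unit p1-unit = trans (A₋-∷ p1) (heads-vanish (when-n≟1+n (suc n)) (when-n≟2+n n))
    A₋-∷-unit m1-unit = trans (A₋-∷ m1) (heads-vanish (when-n≟2+n n) (when-n≟1+n (suc n)))

    A₀-∷-zero : A₀ g (z ∷ w) ≈ A₀ (slice z g) w
    A₀-∷-zero = +-identityˡ _

    A₀-∷-unit : ∀ {x} → IsUnit x → A₀ g (x ∷ w) ≈ g (neg x ∷ w) + A₀ (slice x g) w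
    A₀-∷-unit p1-unit = refl
    A₀-∷-unit m1-unit = refl

  natR-+ : ∀ m n → natR (m ℕ.+ n) ≈ natR m + natR n
  natR-+ zero    n = sym (+-identityˡ _)
  natR-+ (suc m) n = trans (+-congˡ (natR-+ m n)) (sym (+-assoc 1# (natR m) (natR n)))

  natR-suc-* : ∀ n y → natR (suc n) * y ≈ y + natR n * y
  natR-suc-* n y = trans (distribʳ y 1# (natR n)) (+-congʳ (*-identityˡ y))

  natR-2*suc : ∀ n y → natR (2 ℕ.* suc n) * y ≈ y + (y + natR (2 ℕ.* n) * y)
  natR-2*suc n y = begin
    natR (2 ℕ.* suc n) * y         ≡⟨ P.cong (λ t → natR t * y) (*-suc 2 n) ⟩
    natR (2 ℕ.+ 2 ℕ.* n) * y       ≈⟨ natR-suc-* (1 ℕ.+ 2 ℕ.* n) y ⟩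
    y + natR (1 ℕ.+ 2 ℕ.* n) * y   ≈⟨ +-congˡ (natR-suc-* (2 ℕ.* n) y) ⟩
    y + (y + natR (2 ℕ.* n) * y)   ∎

  natR-3*suc : ∀ n y → natR (3 ℕ.* suc n) * y ≈ y + (y + (y + natR (3 ℕ.* n) * y))
  natR-3*suc n y = begin
    natR (3 ℕ.* suc n) * y                 ≡⟨ P.cong (λ t → natR t * y) (*-suc 3 n) ⟩
    natR (3 ℕ.+ 3 ℕ.* n) * y               ≈⟨ natR-suc-* (2 ℕ.+ 3 ℕ.* n) y ⟩
    y + natR (2 ℕ.+ 3 ℕ.* n) * y           ≈⟨ +-congˡ (natR-suc-* (1 ℕ.+ 3 ℕ.* n) y) ⟩
    y + (y + natR (1 ℕ.+ 3 ℕ.* n) * y)     ≈⟨ +-congˡ (+-congˡ (natR-suc-* (3 ℕ.* n) y)) ⟩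
    y + (y + (y + natR (3 ℕ.* n) * y))     ∎

  natR-3*d-∷-unit : ∀ {N x} (w : Vertex N) → IsUnit x → ∀ y →
                    natR (3 ℕ.* d (x ∷ w)) * y ≈ y + (y + (y + natR (3 ℕ.* d w) * y))
  natR-3*d-∷-unit w p1-unit = natR-3*suc (d w)
  natR-3*d-∷-unit w m1-unit = natR-3*suc (d w)

  A₋A₊-Relation : ∀ {N} → VFun N → Vertex N → Set ℓ
  A₋A₊-Relation {N} g v =
    A₋ (A₊ g) v + natR (3 ℕ.* d v) * g v + A₀ g v ≈ A₊ (A₋ g) v + natR (2 ℕ.* N) * g v

  A₀A₊-Relation : ∀ {N} → VFun N → Vertex N → Set ℓ
  A₀A₊-Relation g v = A₀ (A₊ g) v ≈ A₊ (A₀ g) v + A₊ g v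

  module _ {N} (ih : ∀ (h : VFun N) u → A₋A₊-Relation h u) (g : VFun (suc N)) (w : Vertex N) where
    A₋A₊-relation-∷-zero : A₋A₊-Relation g (z ∷ w)
    A₋A₊-relation-∷-zero = begin
      A₋ (A₊ g) (z ∷ w) + natR (3 ℕ.* d w) * a + A₀ g (z ∷ w)
        ≈⟨ +-cong (+-congʳ A₋A₊g) (A₀-∷-zero g w) ⟩
      ((a + A₊ g₊ w) + (a + A₊ g₋ w) + A₋ (A₊ g₀) w) + natR (3 ℕ.* d w) * a + A₀ g₀ w
        ≈⟨ regroup₁ _ _ _ _ _ _ ⟩
      (a + a + (A₊ g₊ w + A₊ g₋ w)) + (A₋ (A₊ g₀) w + natR (3 ℕ.* d w) * a + A₀ g₀ w)
        ≈⟨ +-congˡ (ih g₀ w) ⟩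
      (a + a + (A₊ g₊ w + A₊ g₋ w)) + (A₊ (A₋ g₀) w + natR (2 ℕ.* N) * a)
        ≈⟨ regroup₂ _ _ _ _ _ ⟩
      (A₊ g₊ w + A₊ g₋ w + A₊ (A₋ g₀) w) + (a + (a + natR (2 ℕ.* N) * a))
        ≈⟨ +-cong A₊A₋g (natR-2*suc N a) ⟨
      A₊ (A₋ g) (z ∷ w) + natR (2 ℕ.* suc N) * a ∎
      where
      a = g (z ∷ w)
      g₊ = slice p1 g
      g₋ = slice m1 g
      g₀ = slice z g

      A₋A₊g : A₋ (A₊ g) (z ∷ w) ≈ (a + A₊ g₊ w) + (a + A₊ g₋ w) + A₋ (A₊ g₀) w
      A₋A₊g = trans (A₋-∷-zero (A₊ g) w p1-unit)
        (+-cong (+-cong (A₊-∷-unit g w p1-unit) (A₊-∷-unit g w m1-unit)) (cong A₋-linear (A₊-∷-zero g) w))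

      A₊A₋g : A₊ (A₋ g) (z ∷ w) ≈ (A₊ g₊ w + A₊ g₋ w) + A₊ (A₋ g₀) w
      A₊A₋g = begin
        A₊ (A₋ g) (z ∷ w)                                  ≈⟨ A₊-∷-zero (A₋ g) w ⟩
        A₊ (slice z (A₋ g)) w                              ≈⟨ cong A₊-linear (λ u → A₋-∷-zero g u p1-unit) w ⟩
        A₊ (λ u → (g₊ u + g₋ u) + A₋ g₀ u) w               ≈⟨ additive A₊-linear (λ u → g₊ u + g₋ u) (A₋ g₀) w ⟩
        A₊ (λ u → g₊ u + g₋ u) w + A₊ (A₋ g₀) w            ≈⟨ +-congʳ (additive A₊-linear g₊ g₋ w) ⟩
        (A₊ g₊ w + A₊ g₋ w) + A₊ (A₋ g₀) w                 ∎

      regroup₁ : ∀ a P Q X T Y → ((a + P) + (a + Q) + X) + T + Y ≈ (a + a + (P + Q)) + (X + T + Y)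
      regroup₁ = solve 6 (λ a P Q X T Y →
        ((((a ⊕ P) ⊕ (a ⊕ Q)) ⊕ X) ⊕ T) ⊕ Y ⊜ ((a ⊕ a) ⊕ (P ⊕ Q)) ⊕ ((X ⊕ T) ⊕ Y)) refl

      regroup₂ : ∀ a P Q Z U → (a + a + (P + Q)) + (Z + U) ≈ (P + Q + Z) + (a + (a + U))
      regroup₂ = solve 5 (λ a P Q Z U →
        ((a ⊕ a) ⊕ (P ⊕ Q)) ⊕ (Z ⊕ U) ⊜ ((P ⊕ Q) ⊕ Z) ⊕ (a ⊕ (a ⊕ U))) refl

    A₋A₊-relation-∷-unit : ∀ {x} → IsUnit x → A₋A₊-Relation g (x ∷ w)
    A₋A₊-relation-∷-unit {x} u = begin
      A₋ (A₊ g) (x ∷ w) + natR (3 ℕ.* d (x ∷ w)) * a + A₀ g (x ∷ w)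
        ≈⟨ +-cong (+-cong A₋A₊g (natR-3*d-∷-unit w u a)) (A₀-∷-unit g w u) ⟩
      (A₋ g₀ w + A₋ (A₊ gₓ) w) + (a + (a + (a + natR (3 ℕ.* d w) * a))) + (ā + A₀ gₓ w)
        ≈⟨ regroup₁ _ _ _ _ _ _ ⟩
      ((a + ā + A₋ g₀ w) + (a + a)) + (A₋ (A₊ gₓ) w + natR (3 ℕ.* d w) * a + A₀ gₓ w)
        ≈⟨ +-congˡ (ih gₓ w) ⟩
      ((a + ā + A₋ g₀ w) + (a + a)) + (A₊ (A₋ gₓ) w + natR (2 ℕ.* N) * a)
        ≈⟨ regroup₂ _ _ _ _ ⟩
      (a + ā + A₋ g₀ w + A₊ (A₋ gₓ) w) + (a + (a + natR (2 ℕ.* N) * a))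
        ≈⟨ +-cong A₊A₋g (natR-2*suc N a) ⟨
      A₊ (A₋ g) (x ∷ w) + natR (2 ℕ.* suc N) * a ∎
      where
      a = g (x ∷ w)
      ā = g (neg x ∷ w)
      gₓ = slice x g
      g₀ = slice z g

      A₋A₊g : A₋ (A₊ g) (x ∷ w) ≈ A₋ g₀ w + A₋ (A₊ gₓ) w
      A₋A₊g = begin
        A₋ (A₊ g) (x ∷ w)                     ≈⟨ A₋-∷-unit (A₊ g) w u ⟩
        A₋ (slice x (A₊ g)) w                 ≈⟨ cong A₋-linear (λ v → A₊-∷-unit g v u) w ⟩
        A₋ (λ v → g₀ v + A₊ gₓ v) w           ≈⟨ additive A₋-linear g₀ (A₊ gₓ) w ⟩
        A₋ g₀ w + A₋ (A₊ gₓ) w                ∎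

      A₊A₋g : A₊ (A₋ g) (x ∷ w) ≈ a + ā + A₋ g₀ w + A₊ (A₋ gₓ) w
      A₊A₋g = trans (A₊-∷-unit (A₋ g) w u)
        (+-cong (A₋-∷-zero g w u) (cong A₊-linear (λ v → A₋-∷-unit g v u) w))

      regroup₁ : ∀ a ā P X T Y →
                 (P + X) + (a + (a + (a + T))) + (ā + Y) ≈ ((a + ā + P) + (a + a)) + (X + T + Y)
      regroup₁ = solve 6 (λ a ā P X T Y →
        ((P ⊕ X) ⊕ (a ⊕ (a ⊕ (a ⊕ T)))) ⊕ (ā ⊕ Y) ⊜ (((a ⊕ ā) ⊕ P) ⊕ (a ⊕ a)) ⊕ ((X ⊕ T) ⊕ Y)) refl

      regroup₂ : ∀ a Q Z U → (Q + (a + a)) + (Z + U) ≈ (Q + Z) + (a + (a + U))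
      regroup₂ = solve 4 (λ a Q Z U →
        (Q ⊕ (a ⊕ a)) ⊕ (Z ⊕ U) ⊜ (Q ⊕ Z) ⊕ (a ⊕ (a ⊕ U))) refl

  A₋A₊-relation : ∀ N (g : VFun N) v → A₋A₊-Relation g v
  A₋A₊-relation zero    g []       = +-identityʳ _
  A₋A₊-relation (suc N) g (z ∷ w)  = A₋A₊-relation-∷-zero (A₋A₊-relation N) g w
  A₋A₊-relation (suc N) g (p1 ∷ w) = A₋A₊-relation-∷-unit (A₋A₊-relation N) g w p1-unit
  A₋A₊-relation (suc N) g (m1 ∷ w) = A₋A₊-relation-∷-unit (A₋A₊-relation N) g w m1-unit

  module _ {N} (ih : ∀ (h : VFun N) u → A₀A₊-Relation h u) (g : VFun (suc N)) (w : Vertex N) where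
    A₀A₊-relation-∷-zero : A₀A₊-Relation g (z ∷ w)
    A₀A₊-relation-∷-zero = begin
      A₀ (A₊ g) (z ∷ w)               ≈⟨ A₀-∷-zero (A₊ g) w ⟩
      A₀ (slice z (A₊ g)) w           ≈⟨ cong A₀-linear (A₊-∷-zero g) w ⟩
      A₀ (A₊ g₀) w                    ≈⟨ ih g₀ w ⟩
      A₊ (A₀ g₀) w + A₊ g₀ w          ≈⟨ +-cong A₊A₀g (A₊-∷-zero g w) ⟨
      A₊ (A₀ g) (z ∷ w) + A₊ g (z ∷ w) ∎
      where
      g₀ = slice z g

      A₊A₀g : A₊ (A₀ g) (z ∷ w) ≈ A₊ (A₀ g₀) w
      A₊A₀g = trans (A₊-∷-zero (A₀ g) w) (cong A₊-linear (A₀-∷-zero g) w)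

    A₀A₊-relation-∷-unit : ∀ {x} → IsUnit x → A₀A₊-Relation g (x ∷ w)
    A₀A₊-relation-∷-unit {x} u = begin
      A₀ (A₊ g) (x ∷ w)
        ≈⟨ A₀-∷-unit (A₊ g) w u ⟩
      A₊ g (neg x ∷ w) + A₀ (slice x (A₊ g)) w
        ≈⟨ +-cong (A₊-∷-unit g w (neg-unit u)) A₀A₊gₓ ⟩
      (b + A₊ gₓ̄ w) + (A₀ g₀ w + A₀ (A₊ gₓ) w)
        ≈⟨ +-congˡ (+-congˡ (ih gₓ w)) ⟩
      (b + A₊ gₓ̄ w) + (A₀ g₀ w + (A₊ (A₀ gₓ) w + A₊ gₓ w))
        ≈⟨ regroup _ _ _ _ _ ⟩
      (A₀ g₀ w + (A₊ gₓ̄ w + A₊ (A₀ gₓ) w)) + (b + A₊ gₓ w)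
        ≈⟨ +-cong A₊A₀g (A₊-∷-unit g w u) ⟨
      A₊ (A₀ g) (x ∷ w) + A₊ g (x ∷ w) ∎
      where
      b = g (z ∷ w)
      gₓ = slice x g
      gₓ̄ = slice (neg x) g
      g₀ = slice z g

      A₀A₊gₓ : A₀ (slice x (A₊ g)) w ≈ A₀ g₀ w + A₀ (A₊ gₓ) w
      A₀A₊gₓ = trans (cong A₀-linear (λ v → A₊-∷-unit g v u) w) (additive A₀-linear g₀ (A₊ gₓ) w)

      A₊A₀g : A₊ (A₀ g) (x ∷ w) ≈ A₀ g₀ w + (A₊ gₓ̄ w + A₊ (A₀ gₓ) w)
      A₊A₀g = trans (A₊-∷-unit (A₀ g) w u) (+-cong (A₀-∷-zero g w)
        (trans (cong A₊-linear (λ v → A₀-∷-unit g v u) w) (additive A₊-linear gₓ̄ (A₀ gₓ) w)))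

      regroup : ∀ b P Z Q T → (b + P) + (Z + (Q + T)) ≈ (Z + (P + Q)) + (b + T)
      regroup = solve 5 (λ b P Z Q T → (b ⊕ P) ⊕ (Z ⊕ (Q ⊕ T)) ⊜ (Z ⊕ (P ⊕ Q)) ⊕ (b ⊕ T)) refl

  A₀A₊-relation : ∀ N (g : VFun N) v → A₀A₊-Relation g v
  A₀A₊-relation zero    g []       = sym (+-identityʳ 0#)
  A₀A₊-relation (suc N) g (z ∷ w)  = A₀A₊-relation-∷-zero (A₀A₊-relation N) g w
  A₀A₊-relation (suc N) g (p1 ∷ w) = A₀A₊-relation-∷-unit (A₀A₊-relation N) g w p1-unit
  A₀A₊-relation (suc N) g (m1 ∷ w) = A₀A₊-relation-∷-unit (A₀A₊-relation N) g w m1-unit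

  SupportedOn : ∀ {N} → ℕ → VFun N → Set ℓ
  SupportedOn s g = ∀ v → d v ≢ s → g v ≈ 0#

  A₊-supportedOn : ∀ {N s} {g : VFun N} → SupportedOn s g → SupportedOn (suc s) (A₊ g)
  A₊-supportedOn {N} {s} {g} supp v dv≢1+s = trans
    (sumFin-cong N λ k → trans (+-cong (vanishes (plusE v k)) (vanishes (minusE v k))) (+-identityʳ 0#))
    (sumFin-zero N)
    where
    vanishes : ∀ u → when ⌊ suc (d u) ≟ d v ⌋ (g u) ≈ 0#
    vanishes u with suc (d u) ≟ d v
    ... | yes 1+du≡dv = supp u (λ du≡s → dv≢1+s (P.trans (P.sym 1+du≡dv) (P.cong suc du≡s)))
    ... | no _        = refl

  supportedOn-level : ∀ {N s} {g : VFun N} → SupportedOn s g →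
                      ∀ (a : ℕ → Carrier) v → a (d v) * g v ≈ a s * g v
  supportedOn-level {s = s} {g} supp a v with d v ≟ s
  ... | yes dv≡s = *-congʳ (reflexive (P.cong a dv≡s))
  ... | no  dv≢s = trans (vanish (a (d v))) (sym (vanish (a s)))
    where
    vanish : ∀ b → b * g v ≈ 0#
    vanish b = trans (*-congˡ (supp v dv≢s)) (zeroʳ b)

  x+y≈z⇒x≈z-y : ∀ {x y z} → x + y ≈ z → x ≈ z - y
  x+y≈z⇒x≈z-y {x} {y} eq = trans (sym (//-rightDividesʳ y x)) (+-congʳ eq)

  A₋A₊-eigen : ∀ {N s κ μ} {h : VFun N} → SupportedOn s h → A₀ h ≋ (λ v → μ * h v) →
               A₊ (A₋ h) ≋ (λ v → κ * h v) →
               A₋ (A₊ h) ≋ λ v → (κ + natR (2 ℕ.* N) - μ - natR (3 ℕ.* s)) * h v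
  A₋A₊-eigen {N} {s} {κ} {μ} {h} supp eigen raise-lower v = begin
    A₋ (A₊ h) v                                   ≈⟨ x+y≈z⇒x≈z-y (x+y≈z⇒x≈z-y relation) ⟩
    κ * y + natR (2 ℕ.* N) * y - μ * y - t * y    ≈⟨ +-congʳ (+-congʳ (distribʳ y κ _)) ⟨
    (κ + natR (2 ℕ.* N)) * y - μ * y - t * y      ≈⟨ +-congʳ ([y-z]x≈yx-zx y _ μ) ⟨
    (κ + natR (2 ℕ.* N) - μ) * y - t * y          ≈⟨ [y-z]x≈yx-zx y _ t ⟨
    (κ + natR (2 ℕ.* N) - μ - t) * y              ∎
    where
    y = h v
    t = natR (3 ℕ.* s)

    relation : A₋ (A₊ h) v + t * y + μ * y ≈ κ * y + natR (2 ℕ.* N) * y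
    relation = begin
      A₋ (A₊ h) v + t * y + μ * y
        ≈⟨ +-cong (+-congˡ (supportedOn-level supp (λ n → natR (3 ℕ.* n)) v)) (eigen v) ⟨
      A₋ (A₊ h) v + natR (3 ℕ.* d v) * y + A₀ h v    ≈⟨ A₋A₊-relation N h v ⟩
      A₊ (A₋ h) v + natR (2 ℕ.* N) * y               ≈⟨ +-congʳ (raise-lower v) ⟩
      κ * y + natR (2 ℕ.* N) * y                     ∎

  iterate-supportedOn : ∀ {N r} {f : VFun N} → SupportedOn r f →
                        ∀ k → SupportedOn (k ℕ.+ r) (iter k A₊ f)
  iterate-supportedOn supp zero    = supp
  iterate-supportedOn supp (suc k) = A₊-supportedOn (iterate-supportedOn supp k)

  iterate-A₀-eigen : ∀ {N μ} {f : VFun N} → A₀ f ≋ (λ v → μ * f v) →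
                     ∀ k → A₀ (iter k A₊ f) ≋ λ v → (μ + natR k) * iter k A₊ f v
  iterate-A₀-eigen {μ = μ} eigen zero    v = trans (eigen v) (*-congʳ (sym (+-identityʳ μ)))
  iterate-A₀-eigen {μ = μ} {f} eigen (suc k) v = begin
    A₀ (A₊ h) v                           ≈⟨ A₀A₊-relation _ h v ⟩
    A₊ (A₀ h) v + A₊ h v                  ≈⟨ +-congʳ (cong A₊-linear (iterate-A₀-eigen eigen k) v) ⟩
    A₊ (λ u → (μ + natR k) * h u) v + y   ≈⟨ +-congʳ (homogeneous A₊-linear (μ + natR k) h v) ⟩
    (μ + natR k) * y + y                  ≈⟨ +-congˡ (*-identityˡ y) ⟨
    (μ + natR k) * y + 1# * y             ≈⟨ distribʳ y _ 1# ⟨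
    (μ + natR k + 1#) * y                 ≈⟨ *-congʳ (xy∙z≈x∙zy μ (natR k) 1#) ⟩
    (μ + natR (suc k)) * y                ∎
    where
    h = iter k A₊ f
    y = A₊ h v

  intR-⊖ : ∀ m n → intR (m ⊖ n) ≈ natR m - natR n
  intR-⊖ m n = x+y≈z⇒x≈z-y (cancel m n)
    where
    cancel : ∀ m n → intR (m ⊖ n) + natR n ≈ natR m
    cancel m       zero    = +-identityʳ _
    cancel zero    (suc n) = -‿inverseˡ _
    cancel (suc m) (suc n) = begin
      intR (suc m ⊖ suc n) + (1# + natR n)  ≡⟨ P.cong (λ i → intR i + _) (ℤP.[1+m]⊖[1+n]≡m⊖n m n) ⟩
      intR (m ⊖ n) + (1# + natR n)          ≈⟨ x∙yz≈y∙xz _ 1# _ ⟩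
      1# + (intR (m ⊖ n) + natR n)          ≈⟨ +-congˡ (cancel m n) ⟩
      1# + natR m                           ∎

  intR-[+-+]-+ : ∀ a b c → intR ((+ a ℤ.- + b) ℤ.- + c) ≈ natR a - natR (b ℕ.+ c)
  intR-[+-+]-+ a b c = trans (reflexive (P.cong intR ([+a-+b]-+c≡a⊖[b+c] a b c))) (intR-⊖ a (b ℕ.+ c))

  m-zero-unfold : ∀ N r λ′ →
                  0# + natR (2 ℕ.* N) - (λ′ + natR 0) - natR (3 ℕ.* r) ≈ m N r 0 λ′
  m-zero-unfold N r λ′ = begin
    0# + A - (λ′ + 0#) - B      ≈⟨ +-congʳ (+-cong (+-identityˡ A) (-‿cong (+-identityʳ λ′))) ⟩
    A - λ′ - B                  ≈⟨ xy∙z≈xz∙y A (- λ′) (- B) ⟩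
    A - B - λ′                  ≈⟨ +-congʳ (intR-⊖ (2 ℕ.* N) (3 ℕ.* r)) ⟨
    intR (2 ℕ.* N ⊖ 3 ℕ.* r) - λ′ ≡⟨ P.cong (λ i → intR i - λ′) (ℤP.m-n≡m⊖n (2 ℕ.* N) (3 ℕ.* r)) ⟨
    m N r 0 λ′                  ∎
    where
    A = natR (2 ℕ.* N)
    B = natR (3 ℕ.* r)

  m-suc-unfold : ∀ N r k λ′ →
    m N r k λ′ + natR (2 ℕ.* N) - (λ′ + natR (suc k)) - natR (3 ℕ.* (suc k ℕ.+ r)) ≈ m N r (suc k) λ′
  m-suc-unfold N r k λ′ = begin
    M + A - (λ′ + J) - natR (3 ℕ.* (j ℕ.+ r))  ≈⟨ +-congˡ (-‿cong level) ⟩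
    M + A - (λ′ + J) - (C + B)                  ≈⟨ rearrange M A λ′ J C B ⟩
    M + (A - (B + (J + C))) - λ′                ≈⟨ +-congʳ (+-congˡ offset) ⟨
    m N r (suc k) λ′                            ∎
    where
    j = suc k
    M = m N r k λ′
    A = natR (2 ℕ.* N)
    B = natR (3 ℕ.* r)
    C = natR (3 ℕ.* j)
    J = natR j

    level : natR (3 ℕ.* (j ℕ.+ r)) ≈ C + B
    level = trans (reflexive (P.cong natR (*-distribˡ-+ 3 j r))) (natR-+ (3 ℕ.* j) (3 ℕ.* r))

    offset : intR (+ (2 ℕ.* N) ℤ.- + (3 ℕ.* r) ℤ.- + (4 ℕ.* j)) ≈ A - (B + (J + C))
    offset = trans (intR-[+-+]-+ (2 ℕ.* N) (3 ℕ.* r) (4 ℕ.* j))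
      (+-congˡ (-‿cong (trans (natR-+ (3 ℕ.* r) (4 ℕ.* j)) (+-congˡ (natR-+ j (3 ℕ.* j))))))

    rearrange : ∀ M A λ′ J C B → M + A - (λ′ + J) - (C + B) ≈ M + (A - (B + (J + C))) - λ′
    rearrange = ring-solve 6 (λ M A λ′ J C B →
      (M ⊞ A ⊞ ⊟ (λ′ ⊞ J) ⊞ ⊟ (C ⊞ B)) ≐ (M ⊞ (A ⊞ ⊟ (B ⊞ (J ⊞ C))) ⊞ ⊟ λ′)) refl

mainTheorem5 : ∀ {c ℓ} (R : CommutativeRing c ℓ) →
    let open CommutativeRing R in
    let open Ops R in
    (N r : ℕ) → 1 ≤ N → r ≤ N → (λ′ : Carrier) → (f : VFun N) →
    (∀ v → d v ≢ r → f v ≈ 0#) →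
    (∀ v → A₀ f v ≈ λ′ * f v) →
    (∀ v → A₋ f v ≈ 0#) →
    (k : ℕ) (v : Vertex N) →
    A₋ (iter (suc k) A₊ f) v ≈ m N r k λ′ * iter k A₊ f v
mainTheorem5 R N r _ _ λ′ f supp eigen harmonic = A₋A₊-iterate
  where
  open CommutativeRing R hiding (zero)
  open Ops R
  open CubeAdjacency R

  h : ℕ → VFun N
  h k = iter k A₊ f

  A₋A₊-iterate : ∀ k → A₋ (A₊ (h k)) ≋ λ v → m N r k λ′ * h k v
  A₋A₊-iterate zero v = trans
    (A₋A₊-eigen supp (iterate-A₀-eigen eigen 0) A₊A₋f v) (*-congʳ (m-zero-unfold N r λ′))
    where
    A₊A₋f : A₊ (A₋ f) ≋ λ u → 0# * f u
    A₊A₋f u = trans (linear-vanishes A₊-linear harmonic u) (sym (zeroˡ (f u)))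
  A₋A₊-iterate (suc k) v = trans
    (A₋A₊-eigen (iterate-supportedOn supp (suc k)) (iterate-A₀-eigen eigen (suc k)) A₊A₋h v)
    (*-congʳ (m-suc-unfold N r k λ′))
    where
    A₊A₋h : A₊ (A₋ (h (suc k))) ≋ λ u → m N r k λ′ * h (suc k) u
    A₊A₋h u = trans (cong A₊-linear (A₋A₊-iterate k) u) (homogeneous A₊-linear _ (h k) u)
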